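{- Let $p,q\ge0$. If the intervals of a graph $G$ are $p$-thin and every metric triangle of $G$ is equilateral of size at most $q$, then $G$ is $\frac{p+q}{2}$-hyperbolic and, hence, $G$ has slimness at most $\frac{3(p+q)+1}{2}$.
   Context: Graphs are finite, simple, unweighted, undirected, connected, with shortest-path distance $d$. The interval is $I(u,v)=\{z: d(u,z)+d(z,v)=d(u,v)\}$; the slice is $S_k(u,v)=\{x\in I(u,v): d(u,x)=k\}$. The intervals of $G$ are $p$-thin if every slice has diameter at most $p$. Three vertices $x,y,z$ form a metric triangle if $I(x,y),I(y,z),I(x,z)$ pairwise intersect only in their common endpoints; it is equilateral of size $k$ if $d(x,y)=d(y,z)=d(z,x)=k$. $G$ is $\delta$-hyperbolic if for any four vertices the two largest of the sums $d(u,v)+d(w,x)$, $d(u,w)+d(v,x)$, $d(u,x)+d(v,w)$ differ by at most $2\delta$. A geodesic triangle (union of shortest paths) is $\varsigma$-slim if every vertex of each side is within distance $\varsigma$ of the union of the other two sides; slimness is the least $\varsigma$ such that all geodesic triangles are $\varsigma$-slim. -}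

module Defs where

open import Data.Nat using (ℕ; zero; suc; _+_; _*_; _≤_; _⊔_; _⊓_)
open import Data.Fin using (Fin)
open import Data.Bool using (Bool; true; false; _∧_; if_then_else_)
open import Data.Bool.ListAction using (any)
open import Data.Fin using () renaming (_≟_ to _≟ᶠ_)
open import Data.Fin.Base using (inject₁; fromℕ)
import Data.List.Base as L
open import Relation.Nullary.Decidable using (⌊_⌋)
open import Relation.Binary.PropositionalEquality using (_≡_)
open import Data.Product using (Σ; ∃; _×_; _,_)
open import Data.Sum using (_⊎_)

record Graph : Set where
  field
    n      : ℕ
    adj    : Fin n → Fin n → Bool
    sym    : ∀ u v → adj u v ≡ adj v u
    irrefl : ∀ u → adj u u ≡ false

  V : Set
  V = Fin n

  reach : ℕ → V → V → Bool
  reach zero    u v = ⌊ u ≟ᶠ v ⌋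
  reach (suc k) u v = any (λ w → adj u w ∧ reach k w v) (L.allFin n)

  firstReach : ℕ → ℕ → V → V → ℕ
  firstReach zero    k u v = k
  firstReach (suc f) k u v = if reach k u v then k else firstReach f (suc k) u v

  d : V → V → ℕ
  d u v = firstReach n 0 u v

  InI : V → V → V → Set
  InI u v z = d u z + d z v ≡ d u v

  InS : ℕ → V → V → V → Set
  InS k u v x = InI u v x × d u x ≡ k

open Graph public

Connected : Graph → Set
Connected G = ∀ u v → ∃ λ k → reach G k u v ≡ true

ThinIntervals : (G : Graph) → ℕ → Set
ThinIntervals G p = ∀ (u v : V G) (k : ℕ) (x y : V G) →
  InS G k u v x → InS G k u v y → d G x y ≤ p

MeetsOnlyAt : (G : Graph) → V G → V G → V G → Set
MeetsOnlyAt G a b c = ∀ z → InI G a b z → InI G b c z → z ≡ b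

MetricTriangle : (G : Graph) → V G → V G → V G → Set
MetricTriangle G x y z =
  MeetsOnlyAt G x y z × MeetsOnlyAt G y z x × MeetsOnlyAt G z x y

EquilateralOfSize : (G : Graph) → V G → V G → V G → ℕ → Set
EquilateralOfSize G x y z k = d G x y ≡ k × d G y z ≡ k × d G z x ≡ k

MetricTrianglesEquilateralAtMost : (G : Graph) → ℕ → Set
MetricTrianglesEquilateralAtMost G q = ∀ x y z → MetricTriangle G x y z →
  Σ ℕ λ k → EquilateralOfSize G x y z k × k ≤ q

max3 : ℕ → ℕ → ℕ → ℕ
max3 a b c = a ⊔ b ⊔ c

med3 : ℕ → ℕ → ℕ → ℕ
med3 a b c = (a ⊓ b) ⊔ ((a ⊔ b) ⊓ c)

-- G is δ-hyperbolic with 2δ = twoδ : the two largest of the three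
-- sums differ by at most 2δ
HyperbolicTwice : (G : Graph) → ℕ → Set
HyperbolicTwice G twoδ = ∀ (u v w x : V G) →
  let s₁ = d G u v + d G w x
      s₂ = d G u w + d G v x
      s₃ = d G u x + d G v w
  in max3 s₁ s₂ s₃ ≤ med3 s₁ s₂ s₃ + twoδ

record Geodesic (G : Graph) (a b : V G) : Set where
  field
    path  : Fin (suc (d G a b)) → V G
    start : path Fin.zero ≡ a
    end   : path (fromℕ (d G a b)) ≡ b
    step  : ∀ (i : Fin (d G a b)) → adj G (path (inject₁ i)) (path (Fin.suc i)) ≡ true

OnGeodesic : {G : Graph} {a b : V G} → Geodesic G a b → V G → Set
OnGeodesic P v = ∃ λ i → Geodesic.path P i ≡ v

-- geodesic triangle with sides P : x–y, Q : y–z, R : z–x is ς-slim,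
-- where ς = twoς / 2 (distances are integers, so d ≤ ς ⇔ 2d ≤ twoς)
SlimTriangleTwice : (G : Graph) (x y z : V G) →
  Geodesic G x y → Geodesic G y z → Geodesic G z x → ℕ → Set
SlimTriangleTwice G x y z P Q R twoς =
  (∀ v → OnGeodesic P v → ∃ λ w → (OnGeodesic Q w ⊎ OnGeodesic R w) × 2 * d G v w ≤ twoς) ×
  (∀ v → OnGeodesic Q v → ∃ λ w → (OnGeodesic R w ⊎ OnGeodesic P w) × 2 * d G v w ≤ twoς) ×
  (∀ v → OnGeodesic R v → ∃ λ w → (OnGeodesic P w ⊎ OnGeodesic Q w) × 2 * d G v w ≤ twoς)

-- slimness of G is at most twoς / 2
SlimnessAtMostTwice : Graph → ℕ → Set
SlimnessAtMostTwice G twoς = ∀ (x y z : V G)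
  (P : Geodesic G x y) (Q : Geodesic G y z) (R : Geodesic G z x) →
  SlimTriangleTwice G x y z P Q R twoς

{-# OPTIONS --safe #-}
module Submission where

-- Let w′ be a vertex of I(w,x) ∩ I(w,z) farthest from w, x′ a vertex of
-- I(x,w′) ∩ I(x,z) farthest from x, and z′ a vertex of I(z,w′) ∩ I(z,x′) farthest from z.
-- Maximality makes w′x′z′ a metric triangle, hence equilateral of some size k ≤ q, and
-- then d(w′,x) + d(w′,z) = d(x,z) + k.  Given a fourth vertex y and the analogous vertex
-- c′ ∈ I(w,y) ∩ I(w,z) with, say, d(w,w′) ≤ d(w,c′), the vertex a of I(w,c′) at distance
-- d(w,w′) from w lies in the same slice of I(w,z) as w′, so d(w′,a) ≤ p; the path
-- x → w′ → a → y then yields the four-point condition with constant K = p + q.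
-- For slimness, a vertex v of the side xy with d(x,v) ≤ (y|z)ₓ (otherwise swap x and y)
-- is compared, by the four-point condition, with the vertex of the side xz at distance
-- d(x,v) − ⌊K/2⌋ from x; both cases of that inequality give distance ≤ K + ⌈K/2⌉.

open import Defs renaming (sym to adj-comm)
open import Data.Nat using (ℕ; zero; suc; _+_; _*_; _∸_; _≤_; _<_; _⊔_; _⊓_; z≤n; s≤s; _≤?_; _<?_; ⌊_/2⌋; ⌈_/2⌉)
open import Data.Nat.Properties
open import Data.Nat.Induction using (<-wellFounded)
open import Data.Nat.Tactic.RingSolver using (solve-∀)
open import Induction.WellFounded using (Acc; acc)
open import Data.Bool using (true; false)
open import Data.Bool.Properties using (T-≡; T-∧; ⇔→≡)
open import Data.Fin using (Fin; toℕ; fromℕ; fromℕ<; inject₁) renaming (zero to fzero; suc to fsuc)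
open import Data.Fin.Properties using (pigeonhole; toℕ-fromℕ<; toℕ<n)
open import Data.List.Base using (List; allFin; filter)
open import Data.List.Extrema.Nat using (argmax; argmax-all; f[xs]≤f[argmax])
open import Data.List.Membership.Propositional using (lose)
open import Data.List.Membership.Propositional.Properties using (∈-allFin; ∈-filter⁺)
open import Data.List.Relation.Unary.All using (lookup)
open import Data.List.Relation.Unary.All.Properties using (all-filter)
open import Data.List.Relation.Unary.Any using (satisfied)
open import Data.List.Relation.Unary.Any.Properties using (any⁺; any⁻)
open import Data.Product using (∃; _×_; _,_; proj₁; proj₂; map₁; map₂)
open import Data.Sum using (_⊎_; inj₁; inj₂)
open import Function using (_∘_; case_of_; mk⇔)
open import Function.Bundles using (module Equivalence)
open import Relation.Binary.PropositionalEquality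
open import Relation.Nullary using (Dec; yes; no; contradiction)
open import Relation.Nullary.Decidable using (toWitness; fromWitness; _×-dec_)
open import Relation.Unary using (Decidable)

open Equivalence using (to; from)

+-squeeze : ∀ {a b c e} → a ≤ b → c ≤ e → b + e ≤ a + c → a ≡ b × c ≡ e
+-squeeze {a} {b} {c} {e} a≤b c≤e b+e≤a+c =
  ≤-antisym a≤b (+-cancelʳ-≤ e b a (≤-trans b+e≤a+c (+-monoʳ-≤ a c≤e))) ,
  ≤-antisym c≤e (+-cancelˡ-≤ b e c (≤-trans b+e≤a+c (+-monoˡ-≤ c a≤b)))

⌊n/2⌋+⌊n/2⌋≤n : ∀ n → ⌊ n /2⌋ + ⌊ n /2⌋ ≤ n
⌊n/2⌋+⌊n/2⌋≤n n = ≤-trans (+-monoʳ-≤ ⌊ n /2⌋ (⌊n/2⌋≤⌈n/2⌉ n)) (≤-reflexive (⌊n/2⌋+⌈n/2⌉≡n n))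

2*[n+⌈n/2⌉]≤3*n+1 : ∀ n → 2 * (n + ⌈ n /2⌉) ≤ 3 * n + 1
2*[n+⌈n/2⌉]≤3*n+1 n = begin
  2 * (n + ⌈ n /2⌉)             ≡⟨ lhs n ⌈ n /2⌉ ⟩
  (n + n) + (⌈ n /2⌉ + ⌈ n /2⌉) ≤⟨ +-monoʳ-≤ (n + n) (⌊n/2⌋+⌊n/2⌋≤n (suc n)) ⟩
  (n + n) + suc n               ≡⟨ rhs n ⟩
  3 * n + 1                     ∎
  where
  open ≤-Reasoning
  lhs : ∀ n c → 2 * (n + c) ≡ (n + n) + (c + c)
  lhs = solve-∀
  rhs : ∀ n → (n + n) + suc n ≡ 3 * n + 1
  rhs = solve-∀

m+m≤n+n⇒m≤n : ∀ {m n} → m + m ≤ n + n → m ≤ n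
m+m≤n+n⇒m≤n {m} {n} m+m≤n+n with m ≤? n
... | yes m≤n = m≤n
... | no  m≰n = contradiction m+m≤n+n (<⇒≱ (+-mono-< (≰⇒> m≰n) (≰⇒> m≰n)))

crossed-sums⇒≤ : ∀ i i′ a b → i + i′ ≤ a + b → i + b ≤ i′ + a → i ≤ a
crossed-sums⇒≤ i i′ a b i+i′≤a+b i+b≤i′+a = m+m≤n+n⇒m≤n (+-cancelʳ-≤ (i′ + b) _ _ (begin
  (i + i) + (i′ + b)   ≡⟨ swap i i′ b ⟩
  (i + i′) + (i + b)   ≤⟨ +-mono-≤ i+i′≤a+b i+b≤i′+a ⟩
  (a + b) + (i′ + a)   ≡⟨ swap′ a b i′ ⟩
  (a + a) + (i′ + b)   ∎))
  where
  open ≤-Reasoning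
  swap : ∀ i i′ b → (i + i) + (i′ + b) ≡ (i + i′) + (i + b)
  swap = solve-∀
  swap′ : ∀ a b i′ → (a + b) + (i′ + a) ≡ (a + a) + (i′ + b)
  swap′ = solve-∀

max3≤med3+ : ∀ a b c k → a ≤ b ⊔ c + k → b ≤ a ⊔ c + k → c ≤ a ⊔ b + k → max3 a b c ≤ med3 a b c + k
max3≤med3+ a b c k a≤ b≤ c≤ with ≤-total c (a ⊔ b)
... | inj₂ a⊔b≤c rewrite m≤n⇒m⊔n≡n a⊔b≤c | m≤n⇒m⊓n≡m a⊔b≤c = ≤-trans c≤ (+-monoˡ-≤ k (m≤n⊔m (a ⊓ b) (a ⊔ b)))
... | inj₁ c≤a⊔b rewrite m≥n⇒m⊔n≡m c≤a⊔b | m≥n⇒m⊓n≡n c≤a⊔b with ≤-total a b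
...   | inj₁ a≤b rewrite m≤n⇒m⊔n≡n a≤b | m≤n⇒m⊓n≡m a≤b = b≤
...   | inj₂ b≤a rewrite m≥n⇒m⊔n≡m b≤a | m≥n⇒m⊓n≡n b≤a = a≤

cancel-middle-≤ : ∀ a j e h K → a + (j + e) ≤ j + h + e + K → a ≤ h + K
cancel-middle-≤ a j e h K le = +-cancelˡ-≤ (j + e) a (h + K) (begin
  j + e + a       ≡⟨ +-comm (j + e) a ⟩
  a + (j + e)     ≤⟨ le ⟩
  j + h + e + K   ≡⟨ shuffle j h e K ⟩
  j + e + (h + K) ∎)
  where
  open ≤-Reasoning
  shuffle : ∀ j h e K → j + h + e + K ≡ j + e + (h + K)
  shuffle = solve-∀

chain-cancel-≤ : ∀ a b s h j K → a + s ≤ b + j + K → b + (j + h) ≤ s + K → a + h ≤ K + K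
chain-cancel-≤ a b s h j K as≤ bjh≤ = +-cancelʳ-≤ (s + j) (a + h) (K + K) (begin
  a + h + (s + j)        ≡⟨ shuffle₁ a h s j ⟩
  a + s + (j + h)        ≤⟨ +-monoˡ-≤ (j + h) as≤ ⟩
  b + j + K + (j + h)    ≡⟨ shuffle₂ b j K h ⟩
  b + (j + h) + (j + K)  ≤⟨ +-monoˡ-≤ (j + K) bjh≤ ⟩
  s + K + (j + K)        ≡⟨ shuffle₃ s K j ⟩
  K + K + (s + j)        ∎)
  where
  open ≤-Reasoning
  shuffle₁ : ∀ a h s j → a + h + (s + j) ≡ a + s + (j + h)
  shuffle₁ = solve-∀
  shuffle₂ : ∀ b j K h → b + j + K + (j + h) ≡ b + (j + h) + (j + K)
  shuffle₂ = solve-∀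
  shuffle₃ : ∀ s K j → s + K + (j + K) ≡ K + K + (s + j)
  shuffle₃ = solve-∀

∃-argmax : ∀ {n} {P : Fin n → Set} → Decidable P → (f : Fin n → ℕ) → ∀ {i} → P i →
           ∃ λ c → P c × (∀ t → P t → f t ≤ f c)
∃-argmax {n} P? f {i} pi = c , argmax-all f pi (all-filter P? (allFin n)) ,
  λ t pt → lookup (f[xs]≤f[argmax] {f = f} i candidates) (∈-filter⁺ P? (∈-allFin t) pt)
  where
  candidates : List (Fin n)
  candidates = filter P? (allFin n)
  c : Fin n
  c = argmax f i candidates

module _ (G : Graph) where

  reach-zero : ∀ {u v} → reach G 0 u v ≡ true → u ≡ v
  reach-zero = toWitness ∘ from T-≡

  reach-refl : ∀ u → reach G 0 u u ≡ true
  reach-refl u = to T-≡ (fromWitness refl)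

  reach-suc⁺ : ∀ k {u w v} → adj G u w ≡ true → reach G k w v ≡ true → reach G (suc k) u v ≡ true
  reach-suc⁺ k {w = w} uw wv =
    to T-≡ (any⁺ _ (lose (∈-allFin w) (from T-∧ (from T-≡ uw , from T-≡ wv))))

  reach-suc⁻ : ∀ k {u v} → reach G (suc k) u v ≡ true →
               ∃ λ w → adj G u w ≡ true × reach G k w v ≡ true
  reach-suc⁻ k r with w , uwv ← satisfied (any⁻ _ (allFin (n G)) (from T-≡ r)) =
    w , to T-≡ (proj₁ (to T-∧ uwv)) , to T-≡ (proj₂ (to T-∧ uwv))

  reach-+ : ∀ k l {u v w} → reach G k u v ≡ true → reach G l v w ≡ true → reach G (k + l) u w ≡ true
  reach-+ zero    l uv vw with refl ← reach-zero uv = vw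
  reach-+ (suc k) l uv vw with _ , uu′ , u′v ← reach-suc⁻ k uv = reach-suc⁺ (k + l) uu′ (reach-+ k l u′v vw)

  reach-split : ∀ k l {u w} → reach G (k + l) u w ≡ true →
                ∃ λ v → reach G k u v ≡ true × reach G l v w ≡ true
  reach-split zero    l {u} uw = u , reach-refl u , uw
  reach-split (suc k) l uw with _ , uu′ , u′w ← reach-suc⁻ (k + l) uw with v , u′v , vw ← reach-split k l u′w =
    v , reach-suc⁺ k uu′ u′v , vw

  reach-split-at : ∀ t {k u w} → t ≤ k → reach G k u w ≡ true →
                   ∃ λ v → reach G t u v ≡ true × reach G (k ∸ t) v w ≡ true
  reach-split-at t {k} t≤k uw = reach-split t (k ∸ t) (subst (λ m → reach G m _ _ ≡ true) (sym (m+[n∸m]≡n t≤k)) uw)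

  reach-sym : ∀ k {u v} → reach G k u v ≡ true → reach G k v u ≡ true
  reach-sym zero uv with refl ← reach-zero uv = uv
  reach-sym (suc k) {u} {v} uv with w , uw , wv ← reach-suc⁻ k uv =
    subst (λ m → reach G m v u ≡ true) (+-comm k 1)
      (reach-+ k 1 (reach-sym k wv) (reach-suc⁺ 0 (trans (adj-comm G w u) uw) (reach-refl u)))

  reach-comm : ∀ k u v → reach G k u v ≡ reach G k v u
  reach-comm k u v = ⇔→≡ (mk⇔ (reach-sym k) (reach-sym k))

  firstReach-≤ : ∀ f k {j u v} → k ≤ j → reach G j u v ≡ true → firstReach G f k u v ≤ j
  firstReach-≤ zero    k k≤j r = k≤j
  firstReach-≤ (suc f) k {u = u} {v} k≤j r with reach G k u v in rk
  ... | true  = k≤j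
  ... | false = firstReach-≤ f (suc k) (≤∧≢⇒< k≤j λ { refl → case trans (sym rk) r of λ () }) r

  firstReach-reach : ∀ f k {j u v} → k ≤ j → j < f + k → reach G j u v ≡ true →
                     reach G (firstReach G f k u v) u v ≡ true
  firstReach-reach zero    k k≤j j<k r = contradiction k≤j (<⇒≱ j<k)
  firstReach-reach (suc f) k {j} {u} {v} k≤j j<f+k r with reach G k u v in rk
  ... | true  = rk
  ... | false = firstReach-reach f (suc k) (≤∧≢⇒< k≤j λ { refl → case trans (sym rk) r of λ () })
                  (subst (j <_) (sym (+-suc f k)) j<f+k) r

  firstReach-comm : ∀ f k u v → firstReach G f k u v ≡ firstReach G f k v u
  firstReach-comm zero    k u v = refl
  firstReach-comm (suc f) k u v rewrite reach-comm k u v | firstReach-comm f (suc k) u v = refl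

  d-sym : ∀ u v → d G u v ≡ d G v u
  d-sym = firstReach-comm (n G) 0

  d-minimal : ∀ j {u v} → reach G j u v ≡ true → d G u v ≤ j
  d-minimal j = firstReach-≤ (n G) 0 z≤n

  reach-shorten : ∀ k {u v} → Acc _<_ k → reach G k u v ≡ true →
                  ∃ λ k′ → k′ < n G × reach G k′ u v ≡ true
  reach-shorten k {u} {v} (acc shorter) r with k <? n G
  ... | yes k<n = k , k<n , r
  ... | no  k≮n = cut-loop (pigeonhole (s≤s (≮⇒≥ k≮n)) (proj₁ ∘ split-at))
    where
    split-at : (i : Fin (suc k)) → ∃ λ w → reach G (toℕ i) u w ≡ true × reach G (k ∸ toℕ i) w v ≡ true
    split-at i = reach-split-at (toℕ i) (≤-pred (toℕ<n i)) r
    cut-loop : (∃ λ i → ∃ λ j → toℕ i < toℕ j × proj₁ (split-at i) ≡ proj₁ (split-at j)) →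
               ∃ λ k′ → k′ < n G × reach G k′ u v ≡ true
    cut-loop (i , j , i<j , same) =
      reach-shorten (toℕ i + (k ∸ toℕ j)) (shorter cut<k)
        (reach-+ (toℕ i) (k ∸ toℕ j) (proj₁ (proj₂ (split-at i)))
          (subst (λ w → reach G (k ∸ toℕ j) w v ≡ true) (sym same) (proj₂ (proj₂ (split-at j)))))
      where
      cut<k : toℕ i + (k ∸ toℕ j) < k
      cut<k = subst (toℕ i + (k ∸ toℕ j) <_) (m+[n∸m]≡n (≤-pred (toℕ<n j))) (+-monoˡ-< (k ∸ toℕ j) i<j)

  FourPoint : ℕ → Set
  FourPoint K = ∀ u v w x → d G u v + d G w x ≤ (d G u w + d G v x) ⊔ (d G u x + d G v w) + K

  fourPoint⇒hyperbolic : ∀ {K} → FourPoint K → HyperbolicTwice G K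
  fourPoint⇒hyperbolic {K} fourPoint u v w x = max3≤med3+ s₁ s₂ s₃ K (fourPoint u v w x)
    (subst (λ m → s₂ ≤ s₁ ⊔ (d G u x + m) + K) (d-sym w v) (fourPoint u w v x))
    (subst₂ (λ m m′ → s₃ ≤ (d G u v + m) ⊔ (d G u w + m′) + K) (d-sym x w) (d-sym x v) (fourPoint u x v w))
    where
    s₁ s₂ s₃ : ℕ
    s₁ = d G u v + d G w x
    s₂ = d G u w + d G v x
    s₃ = d G u x + d G v w

  FarthestCommon : V G → V G → V G → V G → Set
  FarthestCommon a b e c =
    (InI G a b c × InI G a e c) × (∀ t → InI G a b t × InI G a e t → d G a t ≤ d G a c)

  NearMedian : ℕ → V G → V G → V G → V G → Set
  NearMedian q w x z c = (InI G w x c × InI G w z c) × d G c x + d G c z ≤ d G x z + q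

  MeetsSlices : (V G → Set) → V G → V G → Set
  MeetsSlices S a b = ∀ t → t ≤ d G a b → ∃ λ g → S g × InS G t a b g

  Steps : ∀ {m} → (Fin (suc m) → V G) → Set
  Steps f = ∀ i → adj G (f (inject₁ i)) (f (fsuc i)) ≡ true

  module _ (conn : Connected G) where

    reach-d : ∀ u v → reach G (d G u v) u v ≡ true
    reach-d u v with k , r ← conn u v with k′ , k′<n , r′ ← reach-shorten k (<-wellFounded k) r =
      firstReach-reach (n G) 0 z≤n (subst (k′ <_) (sym (+-identityʳ (n G))) k′<n) r′

    d-triangle : ∀ a b c → d G a c ≤ d G a b + d G b c
    d-triangle a b c = d-minimal _ (reach-+ (d G a b) (d G b c) (reach-d a b) (reach-d b c))

    d-refl : ∀ a → d G a a ≡ 0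
    d-refl a = n≤0⇒n≡0 (d-minimal 0 (reach-refl a))

    d≡0⇒≡ : ∀ {a b} → d G a b ≡ 0 → a ≡ b
    d≡0⇒≡ {a} {b} ab≡0 = reach-zero (subst (λ m → reach G m a b ≡ true) ab≡0 (reach-d a b))

    adj⇒d≤1 : ∀ {a b} → adj G a b ≡ true → d G a b ≤ 1
    adj⇒d≤1 {b = b} ab = d-minimal 1 (reach-suc⁺ 0 ab (reach-refl b))

    InI? : ∀ a b → Decidable (InI G a b)
    InI? a b z = d G a z + d G z b ≟ d G a b

    InI-sym : ∀ {a b t} → InI G a b t → InI G b a t
    InI-sym {a} {b} {t} t∈ab = begin
      d G b t + d G t a ≡⟨ cong₂ _+_ (d-sym b t) (d-sym t a) ⟩
      d G t b + d G a t ≡⟨ +-comm (d G t b) (d G a t) ⟩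
      d G a t + d G t b ≡⟨ t∈ab ⟩
      d G a b           ≡⟨ d-sym a b ⟩
      d G b a           ∎
      where open ≡-Reasoning

    InI-left : ∀ a b → InI G a b a
    InI-left a b = cong (_+ d G a b) (d-refl a)

    InI-trans : ∀ {a b c t} → InI G a c b → InI G b c t → InI G a c t × InI G a t b
    InI-trans {a} {b} {c} {t} b∈ac t∈bc =
      ≤-antisym (≤-trans (+-monoˡ-≤ (d G t c) (d-triangle a b t)) (≤-reflexive via-b)) (d-triangle a t c) ,
      ≤-antisym (+-cancelʳ-≤ (d G t c) _ _ (≤-trans (≤-reflexive via-b) (d-triangle a t c))) (d-triangle a b t)
      where
      via-b : d G a b + d G b t + d G t c ≡ d G a c
      via-b = trans (+-assoc (d G a b) (d G b t) (d G t c)) (trans (cong (d G a b +_) t∈bc) b∈ac)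

    InI-nested : ∀ {a b c t} → InI G a c b → InI G a b t → InI G a c t
    InI-nested b∈ac t∈ab = InI-sym (proj₁ (InI-trans (InI-sym b∈ac) (InI-sym t∈ab)))

    InI-≤⇒≡ : ∀ {a b t} → InI G a t b → d G a t ≤ d G a b → t ≡ b
    InI-≤⇒≡ {a} {b} b∈at at≤ab = sym (d≡0⇒≡ (n≤0⇒n≡0 (+-cancelˡ-≤ (d G a b) _ _
      (subst₂ _≤_ (sym b∈at) (sym (+-identityʳ (d G a b))) at≤ab))))

    InS-from-bounds : ∀ {a b c} t → t ≤ d G a b → d G a c ≤ t → d G c b ≤ d G a b ∸ t → InS G t a b c
    InS-from-bounds {a} {b} {c} t t≤ab ac≤t cb≤
      with ac≡t , cb≡ ← +-squeeze ac≤t cb≤ (subst (_≤ d G a c + d G c b) (sym (m+[n∸m]≡n t≤ab)) (d-triangle a c b)) =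
      trans (cong₂ _+_ ac≡t cb≡) (m+[n∸m]≡n t≤ab) , ac≡t

    interval-slice : ∀ {a b} t → t ≤ d G a b → ∃ (InS G t a b)
    interval-slice {a} {b} t t≤ab with c , ac , cb ← reach-split-at t t≤ab (reach-d a b) =
      c , InS-from-bounds t t≤ab (d-minimal t ac) (d-minimal _ cb)

    walk-from-start : ∀ {m} (f : Fin (suc m) → V G) → Steps f → ∀ i → d G (f fzero) (f i) ≤ toℕ i
    walk-from-start f steps fzero = ≤-reflexive (d-refl (f fzero))
    walk-from-start {suc m} f steps (fsuc i) =
      ≤-trans (d-triangle _ (f (fsuc fzero)) _)
              (+-mono-≤ (adj⇒d≤1 (steps fzero)) (walk-from-start (f ∘ fsuc) (steps ∘ fsuc) i))

    walk-to-end : ∀ {m} (f : Fin (suc m) → V G) → Steps f → ∀ i → d G (f i) (f (fromℕ m)) ≤ m ∸ toℕ i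
    walk-to-end {zero} f steps fzero = ≤-reflexive (d-refl (f fzero))
    walk-to-end {suc m} f steps fzero =
      ≤-trans (d-triangle _ (f (fsuc fzero)) _)
              (+-mono-≤ (adj⇒d≤1 (steps fzero)) (walk-to-end (f ∘ fsuc) (steps ∘ fsuc) fzero))
    walk-to-end {suc m} f steps (fsuc i) = walk-to-end (f ∘ fsuc) (steps ∘ fsuc) i

    geodesic-slice : ∀ {a b} (P : Geodesic G a b) (i : Fin (suc (d G a b))) →
                     InS G (toℕ i) a b (Geodesic.path P i)
    geodesic-slice {a} {b} P i = InS-from-bounds (toℕ i) (≤-pred (toℕ<n i))
      (subst (λ s → d G s (path i) ≤ toℕ i) start (walk-from-start path step i))
      (subst (λ e → d G (path i) e ≤ d G a b ∸ toℕ i) end (walk-to-end path step i))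
      where open Geodesic P

    farthestCommon : ∀ a b e → ∃ (FarthestCommon a b e)
    farthestCommon a b e = ∃-argmax (λ t → InI? a b t ×-dec InI? a e t) (d G a) (InI-left a b , InI-left a e)

    farthestCommon-beyond : ∀ {a b e c t} → FarthestCommon a b e c →
                            InI G a b t → InI G a e t → InI G a t c → t ≡ c
    farthestCommon-beyond (_ , farthest) t∈ab t∈ae c∈at = InI-≤⇒≡ c∈at (farthest _ (t∈ab , t∈ae))

    quasiMedian-metricTriangle : ∀ {w x z w′ x′ z′} →
      FarthestCommon w x z w′ → FarthestCommon x w′ z x′ → FarthestCommon z w′ x′ z′ →
      MetricTriangle G w′ x′ z′
    quasiMedian-metricTriangle {w} {x} {z} {w′} {x′} {z′}
      W@((w′∈wx , w′∈wz) , _) X@((x′∈xw′ , x′∈xz) , _) Z@((z′∈zw′ , z′∈zx′) , _) =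
      at-x′ , at-z′ , at-w′
      where
      at-x′ : MeetsOnlyAt G w′ x′ z′
      at-x′ t t∈w′x′ t∈x′z′ = farthestCommon-beyond X t∈xw′ t∈xz x′∈xt
        where
        t∈xw′ : InI G x w′ t
        t∈xw′ = proj₁ (InI-trans x′∈xw′ (InI-sym t∈w′x′))
        x′∈xt : InI G x t x′
        x′∈xt = proj₂ (InI-trans x′∈xw′ (InI-sym t∈w′x′))
        t∈xz : InI G x z t
        t∈xz = proj₁ (InI-trans x′∈xz (InI-sym (proj₁ (InI-trans z′∈zx′ (InI-sym t∈x′z′)))))
      at-z′ : MeetsOnlyAt G x′ z′ w′
      at-z′ t t∈x′z′ t∈z′w′ = farthestCommon-beyond Z t∈zw′ t∈zx′ z′∈zt
        where
        t∈zx′ : InI G z x′ t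
        t∈zx′ = proj₁ (InI-trans z′∈zx′ (InI-sym t∈x′z′))
        z′∈zt : InI G z t z′
        z′∈zt = proj₂ (InI-trans z′∈zx′ (InI-sym t∈x′z′))
        t∈zw′ : InI G z w′ t
        t∈zw′ = proj₁ (InI-trans z′∈zw′ t∈z′w′)
      at-w′ : MeetsOnlyAt G z′ w′ x′
      at-w′ t t∈z′w′ t∈w′x′ = farthestCommon-beyond W t∈wx t∈wz w′∈wt
        where
        t∈wz : InI G w z t
        t∈wz = proj₁ (InI-trans w′∈wz (InI-sym (proj₁ (InI-trans z′∈zw′ t∈z′w′))))
        w′∈wt : InI G w t w′
        w′∈wt = proj₂ (InI-trans w′∈wz (InI-sym (proj₁ (InI-trans z′∈zw′ t∈z′w′))))
        t∈wx : InI G w x t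
        t∈wx = proj₁ (InI-trans w′∈wx (InI-sym (proj₁ (InI-trans x′∈xw′ (InI-sym t∈w′x′)))))

    quasiMedian-excess : ∀ {w x z w′ x′ z′ k} →
      FarthestCommon w x z w′ → FarthestCommon x w′ z x′ → FarthestCommon z w′ x′ z′ →
      EquilateralOfSize G w′ x′ z′ k → d G w′ x + d G w′ z ≡ d G x z + k
    quasiMedian-excess {x = x} {z} {w′} {x′} {z′} {k}
      _ ((x′∈xw′ , x′∈xz) , _) ((z′∈zw′ , z′∈zx′) , _) (w′x′≡k , x′z′≡k , z′w′≡k) = begin
      d G w′ x + d G w′ z                               ≡⟨ cong₂ _+_ (sym (InI-sym x′∈xw′)) (sym (InI-sym z′∈zw′)) ⟩
      (d G w′ x′ + d G x′ x) + (d G w′ z′ + d G z′ z)   ≡⟨ cong₂ (λ a b → (a + d G x′ x) + (b + d G z′ z)) w′x′≡k (trans (d-sym w′ z′) z′w′≡k) ⟩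
      (k + d G x′ x) + (k + d G z′ z)                   ≡⟨ shuffle k (d G x′ x) (d G z′ z) ⟩
      (d G x′ x + (k + d G z′ z)) + k                   ≡⟨ cong₂ (λ a b → (a + (b + d G z′ z)) + k) (d-sym x′ x) (sym x′z′≡k) ⟩
      (d G x x′ + (d G x′ z′ + d G z′ z)) + k           ≡⟨ cong (λ m → (d G x x′ + m) + k) (InI-sym z′∈zx′) ⟩
      (d G x x′ + d G x′ z) + k                         ≡⟨ cong (_+ k) x′∈xz ⟩
      d G x z + k                                       ∎
      where
      open ≡-Reasoning
      shuffle : ∀ k a b → (k + a) + (k + b) ≡ (a + (k + b)) + k
      shuffle = solve-∀

    nearMedian : ∀ {q} → MetricTrianglesEquilateralAtMost G q → ∀ w x z → ∃ (NearMedian q w x z)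
    nearMedian {q} equilateral w x z
      with w′ , W ← farthestCommon w x z
      with x′ , X ← farthestCommon x w′ z
      with z′ , Z ← farthestCommon z w′ x′
      with k , sides , k≤q ← equilateral w′ x′ z′ (quasiMedian-metricTriangle W X Z) =
      w′ , proj₁ W , subst (_≤ d G x z + q) (sym (quasiMedian-excess W X Z sides)) (+-monoʳ-≤ (d G x z) k≤q)

    thin⇒fourPoint-half : ∀ {p q} → ThinIntervals G p → ∀ {w x y z c c′} →
      InI G w z c → d G c x + d G c z ≤ d G x z + q →
      InI G w y c′ → InI G w z c′ → d G w c ≤ d G w c′ →
      d G x y + d G w z ≤ d G x z + d G y w + (p + q)
    thin⇒fourPoint-half {p} {q} thin {w} {x} {y} {z} {c} {c′} c∈wz excess c′∈wy c′∈wz wc≤wc′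
      with a , a∈wc′ , wa≡wc ← interval-slice (d G w c) wc≤wc′ = begin
      d G x y + d G w z                                   ≤⟨ +-mono-≤ x→c→a→y (≤-reflexive (sym c∈wz)) ⟩
      (d G c x + d G c a + d G a y) + (d G w c + d G c z) ≡⟨ shuffle (d G c x) (d G c a) (d G a y) (d G w c) (d G c z) ⟩
      (d G c x + d G c z) + (d G w c + d G a y) + d G c a ≤⟨ +-mono-≤ (+-monoˡ-≤ _ excess) ca≤p ⟩
      (d G x z + q) + (d G w c + d G a y) + p             ≡⟨ cong (λ m → (d G x z + q) + m + p) w→a→y ⟩
      (d G x z + q) + d G y w + p                         ≡⟨ shuffle′ (d G x z) q (d G y w) p ⟩
      d G x z + d G y w + (p + q)                         ∎
      where
      open ≤-Reasoning
      ca≤p : d G c a ≤ p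
      ca≤p = thin w z (d G w c) c a (c∈wz , refl) (InI-nested c′∈wz a∈wc′ , wa≡wc)
      x→c→a→y : d G x y ≤ d G c x + d G c a + d G a y
      x→c→a→y = ≤-trans (d-triangle x a y)
        (+-monoˡ-≤ _ (subst (λ m → d G x a ≤ m + d G c a) (d-sym x c) (d-triangle x c a)))
      w→a→y : d G w c + d G a y ≡ d G y w
      w→a→y = trans (cong (_+ d G a y) (sym wa≡wc)) (trans (InI-nested c′∈wy a∈wc′) (d-sym w y))
      shuffle : ∀ cx ca ay wc cz → (cx + ca + ay) + (wc + cz) ≡ (cx + cz) + (wc + ay) + ca
      shuffle = solve-∀
      shuffle′ : ∀ xz q yw p → (xz + q) + yw + p ≡ xz + yw + (p + q)
      shuffle′ = solve-∀

    thin∧equilateral⇒fourPoint : ∀ {p q} → ThinIntervals G p → MetricTrianglesEquilateralAtMost G q →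
                                 FourPoint (p + q)
    thin∧equilateral⇒fourPoint {p} {q} thin equilateral u v w x =
      compare (nearMedian equilateral w u x) (nearMedian equilateral w v x)
      where
      compare : ∃ (NearMedian q w u x) → ∃ (NearMedian q w v x) →
                d G u v + d G w x ≤ (d G u w + d G v x) ⊔ (d G u x + d G v w) + (p + q)
      compare (c , (c∈wu , c∈wx) , excess) (c′ , (c′∈wv , c′∈wx) , excess′) with ≤-total (d G w c) (d G w c′)
      ... | inj₁ wc≤wc′ =
        ≤-trans (thin⇒fourPoint-half thin {w} {u} {v} {x} {c} {c′} c∈wx excess c′∈wv c′∈wx wc≤wc′)
                (+-monoˡ-≤ (p + q) (m≤n⊔m (d G u w + d G v x) (d G u x + d G v w)))
      ... | inj₂ wc′≤wc =
        ≤-trans (subst₂ (λ a b → a + d G w x ≤ b + (p + q)) (d-sym v u) (+-comm (d G v x) (d G u w))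
                   (thin⇒fourPoint-half thin {w} {v} {u} {x} {c′} {c} c′∈wx excess′ c∈wu c∈wx wc′≤wc))
                (+-monoˡ-≤ (p + q) (m≤m⊔n (d G u w + d G v x) (d G u x + d G v w)))

    geodesic-meetsSlices : ∀ {a b} (P : Geodesic G a b) → MeetsSlices (OnGeodesic P) a b
    geodesic-meetsSlices {a} {b} P t t≤ab =
      path i , (i , refl) , subst (λ s → InS G s a b (path i)) (toℕ-fromℕ< (s≤s t≤ab)) (geodesic-slice P i)
      where
      open Geodesic P
      i : Fin (suc (d G a b))
      i = fromℕ< (s≤s t≤ab)

    meetsSlices-sym : ∀ {S a b} → MeetsSlices S a b → MeetsSlices S b a
    meetsSlices-sym {a = a} {b} meets t t≤ba
      with g , g∈S , g∈ab , ag≡ ← meets (d G a b ∸ t) (m∸n≤m (d G a b) t) =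
      g , g∈S , InI-sym g∈ab , trans (d-sym b g) (complement t≤ab (trans (cong (_+ d G g b) (sym ag≡)) g∈ab))
      where
      t≤ab : t ≤ d G a b
      t≤ab = subst (t ≤_) (d-sym b a) t≤ba
      complement : ∀ {t D e} → t ≤ D → D ∸ t + e ≡ D → e ≡ t
      complement {t} {D} {e} t≤D eq = +-cancelˡ-≡ (D ∸ t) e t (trans eq (sym (m∸n+n≡m t≤D)))

    module _ {K} (fourPoint : FourPoint K) where

      closer⇒vz-bound : ∀ {x y z v} → InI G x y v → d G x v + d G y z ≤ d G v y + d G x z →
                        d G v z + d G x v ≤ d G x z + K
      closer⇒vz-bound {x} {y} {z} {v} v∈xy closer = +-cancelʳ-≤ (d G v y) _ _ (begin
        d G v z + d G x v + d G v y                   ≡⟨ +-assoc (d G v z) (d G x v) (d G v y) ⟩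
        d G v z + (d G x v + d G v y)                 ≡⟨ cong (d G v z +_) v∈xy ⟩
        d G v z + d G x y                             ≤⟨ fourPoint v z x y ⟩
        (d G v x + d G z y) ⊔ (d G v y + d G z x) + K ≡⟨ cong (_+ K) (m≤n⇒m⊔n≡n closer′) ⟩
        d G v y + d G z x + K                         ≡⟨ cong (λ m → d G v y + m + K) (d-sym z x) ⟩
        d G v y + d G x z + K                         ≡⟨ shuffle (d G v y) (d G x z) K ⟩
        d G x z + K + d G v y                         ∎)
        where
        open ≤-Reasoning
        closer′ : d G v x + d G z y ≤ d G v y + d G z x
        closer′ rewrite d-sym v x | d-sym z y | d-sym z x = closer
        shuffle : ∀ a b c → a + b + c ≡ b + c + a
        shuffle = solve-∀

      closer⇒≤ : ∀ {x y z v} → InI G x y v → d G x v + d G y z ≤ d G v y + d G x z → d G x v ≤ d G x z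
      closer⇒≤ {x} {y} {z} {v} v∈xy closer = crossed-sums⇒≤ (d G x v) (d G v y) (d G x z) (d G y z)
        (subst₂ _≤_ (sym v∈xy) (cong (d G x z +_) (d-sym z y)) (d-triangle x z y)) closer

      slice-point-near : ∀ {x z v g j} → InI G x z g → d G x g ≡ j → d G x v ≡ j + ⌊ K /2⌋ →
                         d G v z + d G x v ≤ d G x z + K → d G v g ≤ K + ⌈ K /2⌉
      slice-point-near {x} {z} {v} {g} {j} g∈xz xg≡j xv≡ vz-bound =
        bound (⊔-sel (j + ⌊ K /2⌋ + d G g z) (d G v z + j))
        where
        xz≡ : d G x z ≡ j + d G g z
        xz≡ = trans (sym g∈xz) (cong (_+ d G g z) xg≡j)
        four-point-at-g : ∀ {max} → (j + ⌊ K /2⌋ + d G g z) ⊔ (d G v z + j) ≡ max →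
                          d G v g + (j + d G g z) ≤ max + K
        four-point-at-g max≡ = subst (λ m → d G v g + (j + d G g z) ≤ m + K) max≡
          (subst₂ _≤_ (cong (d G v g +_) xz≡)
            (cong (_+ K) (cong₂ _⊔_ (cong (_+ d G g z) (trans (d-sym v x) xv≡))
                                    (cong (d G v z +_) (trans (d-sym g x) xg≡j))))
            (fourPoint v g x z))
        vz-bound′ : d G v z + (j + ⌊ K /2⌋) ≤ (j + d G g z) + K
        vz-bound′ = subst₂ (λ a b → d G v z + a ≤ b + K) xv≡ xz≡ vz-bound
        K+K≡ : K + K ≡ ⌊ K /2⌋ + (K + ⌈ K /2⌉)
        K+K≡ = begin-equality
          K + K                       ≡⟨ cong (_+ K) (sym (⌊n/2⌋+⌈n/2⌉≡n K)) ⟩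
          ⌊ K /2⌋ + ⌈ K /2⌉ + K       ≡⟨ +-assoc ⌊ K /2⌋ ⌈ K /2⌉ K ⟩
          ⌊ K /2⌋ + (⌈ K /2⌉ + K)     ≡⟨ cong (⌊ K /2⌋ +_) (+-comm ⌈ K /2⌉ K) ⟩
          ⌊ K /2⌋ + (K + ⌈ K /2⌉)     ∎
          where open ≤-Reasoning
        bound : let max = (j + ⌊ K /2⌋ + d G g z) ⊔ (d G v z + j) in
                max ≡ j + ⌊ K /2⌋ + d G g z ⊎ max ≡ d G v z + j → d G v g ≤ K + ⌈ K /2⌉
        bound (inj₁ max≡) =
          ≤-trans (cancel-middle-≤ (d G v g) j (d G g z) ⌊ K /2⌋ K (four-point-at-g max≡))
                  (subst (_≤ K + ⌈ K /2⌉) (+-comm K ⌊ K /2⌋) (+-monoʳ-≤ K (⌊n/2⌋≤⌈n/2⌉ K)))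
        bound (inj₂ max≡) = +-cancelˡ-≤ ⌊ K /2⌋ (d G v g) (K + ⌈ K /2⌉)
          (subst₂ _≤_ (+-comm (d G v g) ⌊ K /2⌋) K+K≡
            (chain-cancel-≤ (d G v g) (d G v z) (j + d G g z) ⌊ K /2⌋ j K (four-point-at-g max≡) vz-bound′))

      -- For v ∈ I(x,y) the third hypothesis says d(x,v) ≤ (y|z)ₓ.
      near-point : ∀ {S x y z v} → MeetsSlices S x z → InI G x y v →
                   d G x v + d G y z ≤ d G v y + d G x z → ∃ λ g → S g × d G v g ≤ K + ⌈ K /2⌉
      near-point {x = x} {v = v} meets v∈xy closer
        with g , g∈S , g∈xz , xg≡ ← meets (d G x v ∸ ⌊ K /2⌋)
                                      (≤-trans (m∸n≤m (d G x v) ⌊ K /2⌋) (closer⇒≤ v∈xy closer)) =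
        g , g∈S , bound (d G x v ≤? ⌊ K /2⌋)
        where
        bound : Dec (d G x v ≤ ⌊ K /2⌋) → d G v g ≤ K + ⌈ K /2⌉
        bound (yes xv≤h) = begin
          d G v g             ≤⟨ d-triangle v x g ⟩
          d G v x + d G x g   ≡⟨ cong₂ _+_ (d-sym v x) (trans xg≡ (m≤n⇒m∸n≡0 xv≤h)) ⟩
          d G x v + 0         ≡⟨ +-identityʳ (d G x v) ⟩
          d G x v             ≤⟨ xv≤h ⟩
          ⌊ K /2⌋             ≤⟨ ⌊n/2⌋≤n K ⟩
          K                   ≤⟨ m≤m+n K ⌈ K /2⌉ ⟩
          K + ⌈ K /2⌉         ∎
          where open ≤-Reasoning
        bound (no xv≰h) =
          slice-point-near g∈xz xg≡ (sym (m∸n+n≡m (<⇒≤ (≰⇒> xv≰h)))) (closer⇒vz-bound v∈xy closer)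

      side-near : ∀ {S₁ S₂ x y z v} → MeetsSlices S₁ y z → MeetsSlices S₂ z x → InI G x y v →
                  ∃ λ g → (S₁ g ⊎ S₂ g) × d G v g ≤ K + ⌈ K /2⌉
      side-near {x = x} {y} {z} {v} meets₁ meets₂ v∈xy with d G x v + d G y z ≤? d G v y + d G x z
      ... | yes closer-x = map₂ (map₁ inj₂) (near-point (meetsSlices-sym meets₂) v∈xy closer-x)
      ... | no  closer-y = map₂ (map₁ inj₁) (near-point meets₁ (InI-sym v∈xy) closer-y′)
        where
        closer-y′ : d G y v + d G x z ≤ d G v x + d G y z
        closer-y′ rewrite d-sym y v | d-sym v x = <⇒≤ (≰⇒> closer-y)

    fourPoint⇒slim : ∀ {K} → FourPoint K → SlimnessAtMostTwice G (3 * K + 1)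
    fourPoint⇒slim {K} fourPoint x y z P Q R = near P Q R , near Q R P , near R P Q
      where
      near : ∀ {a b c} (A : Geodesic G a b) (B : Geodesic G b c) (C : Geodesic G c a) v → OnGeodesic A v →
             ∃ λ w → (OnGeodesic B w ⊎ OnGeodesic C w) × 2 * d G v w ≤ 3 * K + 1
      near A B C _ (i , refl) =
        map₂ (map₂ (λ vw≤ → ≤-trans (*-monoʳ-≤ 2 vw≤) (2*[n+⌈n/2⌉]≤3*n+1 K)))
          (side-near fourPoint (geodesic-meetsSlices B) (geodesic-meetsSlices C) (proj₁ (geodesic-slice A i)))

corollary1 : (p q : ℕ) (G : Graph) → Connected G →
    ThinIntervals G p → MetricTrianglesEquilateralAtMost G q →
    HyperbolicTwice G (p + q) × SlimnessAtMostTwice G (3 * (p + q) + 1)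
corollary1 p q G conn thin equilateral = fourPoint⇒hyperbolic G fourPoint , fourPoint⇒slim G conn fourPoint
  where
  fourPoint : FourPoint G (p + q)
  fourPoint = thin∧equilateral⇒fourPoint G conn thin equilateral
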